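{- Let $n$ be a positive integer such that $\log_2 n$ is an integer, let $X$ be an $n\times n$ Boolean matrix, and define $P_0=X$ and $P_k=P_{k-1}+P_{k-1}^2+P_{k-1}^3$ for $k>0$. Then $X^*=I_n+P_{\log_2 n}$.
   Context: Boolean matrices are added and multiplied in the Boolean semiring ($+$ is entrywise OR, product is Boolean matrix product). $I_n$ is the identity matrix and $X^*=\sum_{t\ge0}X^t$ (with $X^0=I_n$) is the Kleene (reflexive transitive) closure of $X$. -}

module Defs where

open import Data.Nat using (ℕ; zero; suc)
open import Data.Bool using (Bool; true; false; _∨_; _∧_)
open import Data.Fin using (Fin; _≟_)
open import Data.Product using (∃)
open import Relation.Binary.PropositionalEquality using (_≡_)
open import Relation.Nullary.Decidable using (⌊_⌋)

BMat : ℕ → Set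
BMat n = Fin n → Fin n → Bool

big∨ : (n : ℕ) → (Fin n → Bool) → Bool
big∨ zero    f = false
big∨ (suc n) f = f Fin.zero ∨ big∨ n (λ k → f (Fin.suc k))

I : (n : ℕ) → BMat n
I n i j = ⌊ i ≟ j ⌋

_⊕_ : {n : ℕ} → BMat n → BMat n → BMat n
(A ⊕ B) i j = A i j ∨ B i j

_⊗_ : {n : ℕ} → BMat n → BMat n → BMat n
_⊗_ {n} A B i j = big∨ n (λ k → A i k ∧ B k j)

infixl 6 _⊕_
infixl 7 _⊗_

pow : {n : ℕ} → BMat n → ℕ → BMat n
pow {n} X zero    = I n
pow {n} X (suc t) = pow X t ⊗ X

-- Kleene closure X* = Σ_{t ≥ 0} X^t : entry (i,j) is true iff some X^t has entry true
star : {n : ℕ} → BMat n → Fin n → Fin n → Set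
star X i j = ∃ λ t → pow X t i j ≡ true

P : {n : ℕ} → BMat n → ℕ → BMat n
P X zero    = X
P X (suc k) = let Q = P X k in Q ⊕ Q ⊗ Q ⊕ Q ⊗ Q ⊗ Q

-- Entry (i, j) of X^t says that the digraph X has a walk of length t from i to j.
-- By induction on k, P_k has entry (i, j) exactly when there is such a walk of
-- length 1 ≤ t ≤ 3^k: one step of the recursion concatenates at most three walks,
-- and conversely cuts a walk of length ≤ 3^(k+1) into at most three pieces of
-- length ≤ 3^k. A walk of length > n visits some vertex twice among its first
-- n + 1 positions, so cutting out that closed subwalk shortens every walk to
-- length ≤ n ≤ 3^(log₂ n); the identity accounts for the walks of length 0.
module Submission where

open import Defs
open import Data.Nat using (ℕ; _^_)
open import Data.Bool using (true)
open import Data.Fin using (Fin)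
open import Relation.Binary.PropositionalEquality using (_≡_)
open import Function.Bundles using (_⇔_)

open import Data.Nat using (zero; suc; _+_; _∸_; _≤_; _<_; _≤?_; z≤n; s≤s)
open import Data.Nat.Properties
open import Data.Nat.Induction using (<-rec)
open import Data.Bool using (Bool; false; _∨_; _∧_)
open import Data.Bool.Properties using (T-≡; ∨-zeroˡ; ∨-zeroʳ; ∧-conicalˡ; ∧-conicalʳ)
open import Data.Fin using (toℕ)
open import Data.Fin.Properties using (pigeonhole; toℕ≤pred[n])
open import Data.Product using (∃; _×_; _,_; proj₁; proj₂; map₁)
open import Data.Sum using (_⊎_; inj₁; inj₂)
open import Function.Bundles using (mk⇔; module Equivalence)
open import Relation.Nullary using (yes; no)
open import Relation.Nullary.Decidable using (toWitness; fromWitness)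
open import Relation.Binary.PropositionalEquality using (refl; sym; subst; cong; cong₂)

variable
  n t c d : ℕ
  i j k : Fin n

∨-trueˡ : ∀ {a} b → a ≡ true → a ∨ b ≡ true
∨-trueˡ b refl = ∨-zeroˡ b

∨-trueʳ : ∀ a {b} → b ≡ true → a ∨ b ≡ true
∨-trueʳ a refl = ∨-zeroʳ a

∨-true-elim : ∀ a {b} → a ∨ b ≡ true → a ≡ true ⊎ b ≡ true
∨-true-elim true  _ = inj₁ refl
∨-true-elim false e = inj₂ e

⊕-introˡ : (A B : BMat n) → A i j ≡ true → (A ⊕ B) i j ≡ true
⊕-introˡ {i = i} {j = j} A B = ∨-trueˡ (B i j)

⊕-introʳ : (A B : BMat n) → B i j ≡ true → (A ⊕ B) i j ≡ true
⊕-introʳ {i = i} {j = j} A B = ∨-trueʳ (A i j)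

⊕-elim : (A B : BMat n) → (A ⊕ B) i j ≡ true → A i j ≡ true ⊎ B i j ≡ true
⊕-elim {i = i} A B = ∨-true-elim (A i _)

big∨-intro : (f : Fin n → Bool) (k : Fin n) → f k ≡ true → big∨ n f ≡ true
big∨-intro f Fin.zero    e = ∨-trueˡ _ e
big∨-intro f (Fin.suc k) e = ∨-trueʳ (f Fin.zero) (big∨-intro (λ l → f (Fin.suc l)) k e)

big∨-elim : (f : Fin n → Bool) → big∨ n f ≡ true → ∃ λ k → f k ≡ true
big∨-elim {suc n} f e with ∨-true-elim (f Fin.zero) e
... | inj₁ e₀ = Fin.zero , e₀
... | inj₂ e₁ with big∨-elim (λ l → f (Fin.suc l)) e₁
...   | k , eₖ = Fin.suc k , eₖ

⊗-intro : (A B : BMat n) → A i k ≡ true → B k j ≡ true → (A ⊗ B) i j ≡ true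
⊗-intro {k = k} A B eᴬ eᴮ = big∨-intro _ k (cong₂ _∧_ eᴬ eᴮ)

⊗-elim : (A B : BMat n) → (A ⊗ B) i j ≡ true → ∃ λ k → A i k ≡ true × B k j ≡ true
⊗-elim A B e with big∨-elim _ e
... | k , eₖ = k , ∧-conicalˡ _ _ eₖ , ∧-conicalʳ _ _ eₖ

I-refl : I n i i ≡ true
I-refl = Equivalence.to T-≡ (fromWitness refl)

I-true⇒≡ : I n i j ≡ true → i ≡ j
I-true⇒≡ e = toWitness (Equivalence.from T-≡ e)

data Walk (X : BMat n) : ℕ → Fin n → Fin n → Set where
  []  : Walk X 0 i i
  _∷_ : X i k ≡ true → Walk X t k j → Walk X (suc t) i j

infixr 5 _∷_

module _ {X : BMat n} where

  infixr 5 _++_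

  _++_ : Walk X c i k → Walk X d k j → Walk X (c + d) i j
  []      ++ w = w
  (e ∷ v) ++ w = e ∷ (v ++ w)

  _∷ʳ_ : Walk X t i k → X k j ≡ true → Walk X (suc t) i j
  []      ∷ʳ e = e ∷ []
  (f ∷ w) ∷ʳ e = f ∷ (w ∷ʳ e)

  unsnoc : Walk X (suc t) i j → ∃ λ k → Walk X t i k × X k j ≡ true
  unsnoc (e ∷ [])      = _ , [] , e
  unsnoc (e ∷ (f ∷ w)) with unsnoc (f ∷ w)
  ... | k , v , g = k , e ∷ v , g

  pow-true⇒Walk : ∀ t → pow X t i j ≡ true → Walk X t i j
  pow-true⇒Walk zero    e rewrite I-true⇒≡ e = []
  pow-true⇒Walk (suc t) e with ⊗-elim (pow X t) X e
  ... | _ , eₜ , e₁ = pow-true⇒Walk t eₜ ∷ʳ e₁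

  Walk⇒pow-true : Walk X t i j → pow X t i j ≡ true
  Walk⇒pow-true []          = I-refl
  Walk⇒pow-true {t = suc t} w@(_ ∷ _) with unsnoc w
  ... | _ , v , e = ⊗-intro (pow X t) X (Walk⇒pow-true v) e

  -- For positions s ≥ t this is the last vertex j.
  vertex : Walk X t i j → ℕ → Fin n
  vertex {i = i} []      _       = i
  vertex {i = i} (e ∷ w) zero    = i
  vertex         (e ∷ w) (suc s) = vertex w s

  splitAt : ∀ s → s ≤ t → (w : Walk X t i j) →
            Walk X s i (vertex w s) × Walk X (t ∸ s) (vertex w s) j
  splitAt zero    _         []      = [] , []
  splitAt zero    _         (e ∷ w) = [] , e ∷ w
  splitAt (suc s) (s≤s s≤t) (e ∷ w) = map₁ (e ∷_) (splitAt s s≤t w)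

  shortcut : n < t → Walk X t i j → ∃ λ s → s < t × Walk X s i j
  shortcut {t = t} n<t w with pigeonhole (n<1+n _) (λ p → vertex w (toℕ p))
  ... | p , q , a<b , same = a + (t ∸ b) , shorter , prefix ++ suffix
    where
    a = toℕ p
    b = toℕ q
    b≤t : b ≤ t
    b≤t = ≤-trans (toℕ≤pred[n] q) (<⇒≤ n<t)
    prefix : Walk X a _ (vertex w a)
    prefix = proj₁ (splitAt a (≤-trans (<⇒≤ a<b) b≤t) w)
    suffix : Walk X (t ∸ b) (vertex w a) _
    suffix = subst (λ v → Walk X (t ∸ b) v _) (sym same) (proj₂ (splitAt b b≤t w))
    shorter : a + (t ∸ b) < t
    shorter = subst (a + (t ∸ b) <_) (m+[n∸m]≡n b≤t) (+-monoˡ-< (t ∸ b) a<b)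

  shorten : Walk X t i j → ∃ λ s → s ≤ n × Walk X s i j
  shorten {t = t} = <-rec Shortenable go t
    where
    Shortenable : ℕ → Set
    Shortenable t = ∀ {i j} → Walk X t i j → ∃ λ s → s ≤ n × Walk X s i j
    go : ∀ t → (∀ {s} → s < t → Shortenable s) → Shortenable t
    go t rec w with t ≤? n
    ... | yes t≤n = t , t≤n , w
    ... | no  t≰n with shortcut (≰⇒> t≰n) w
    ...   | s , s<t , v = rec s<t v

BoundedWalk : BMat n → ℕ → Fin n → Fin n → Set
BoundedWalk X c i j = ∃ λ t → 0 < t × t ≤ c × Walk X t i j

3^[1+k]≡3^k+[3^k+3^k] : ∀ k → 3 ^ suc k ≡ 3 ^ k + (3 ^ k + 3 ^ k)
3^[1+k]≡3^k+[3^k+3^k] k = cong (λ x → 3 ^ k + (3 ^ k + x)) (+-identityʳ (3 ^ k))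

module _ {X : BMat n} where

  BoundedWalk-mono : c ≤ d → BoundedWalk X c i j → BoundedWalk X d i j
  BoundedWalk-mono c≤d (t , 0<t , t≤c , w) = t , 0<t , ≤-trans t≤c c≤d , w

  Walk⇒BoundedWalk : 0 < t → Walk X t i j → BoundedWalk X t i j
  Walk⇒BoundedWalk 0<t w = _ , 0<t , ≤-refl , w

  _++ᵇ_ : BoundedWalk X c i k → BoundedWalk X d k j → BoundedWalk X (c + d) i j
  (s , 0<s , s≤c , v) ++ᵇ (t , _ , t≤d , w) =
    s + t , <-≤-trans 0<s (m≤m+n s t) , +-mono-≤ s≤c t≤d , v ++ w

  splitBounded : c < t → t ≤ c + d → Walk X t i j →
                 ∃ λ k → Walk X c i k × BoundedWalk X d k j
  splitBounded {c = c} {t = t} c<t t≤c+d w =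
    vertex w c , proj₁ parts ,
    t ∸ c , m<n⇒0<n∸m c<t , m≤n+o⇒m∸n≤o t c t≤c+d , proj₂ parts
    where parts = splitAt c (<⇒≤ c<t) w

  P-suc-elim : ∀ k → let Q = P X k in P X (suc k) i j ≡ true →
               Q i j ≡ true ⊎ (Q ⊗ Q) i j ≡ true ⊎ (Q ⊗ Q ⊗ Q) i j ≡ true
  P-suc-elim k e with ⊕-elim (P X k ⊕ P X k ⊗ P X k) (P X k ⊗ P X k ⊗ P X k) e
  ... | inj₂ e₃ = inj₂ (inj₂ e₃)
  ... | inj₁ e₁₂ with ⊕-elim (P X k) (P X k ⊗ P X k) e₁₂
  ...   | inj₁ e₁ = inj₁ e₁
  ...   | inj₂ e₂ = inj₂ (inj₁ e₂)

  P-suc-intro₁ : ∀ k → P X k i j ≡ true → P X (suc k) i j ≡ true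
  P-suc-intro₁ k e = ⊕-introˡ (P X k ⊕ P X k ⊗ P X k) (P X k ⊗ P X k ⊗ P X k)
                       (⊕-introˡ (P X k) (P X k ⊗ P X k) e)

  P-suc-intro₂ : ∀ k → (P X k ⊗ P X k) i j ≡ true → P X (suc k) i j ≡ true
  P-suc-intro₂ k e = ⊕-introˡ (P X k ⊕ P X k ⊗ P X k) (P X k ⊗ P X k ⊗ P X k)
                       (⊕-introʳ (P X k) (P X k ⊗ P X k) e)

  P-suc-intro₃ : ∀ k → (P X k ⊗ P X k ⊗ P X k) i j ≡ true → P X (suc k) i j ≡ true
  P-suc-intro₃ k = ⊕-introʳ (P X k ⊕ P X k ⊗ P X k) (P X k ⊗ P X k ⊗ P X k)

  P-true⇒BoundedWalk : ∀ k → P X k i j ≡ true → BoundedWalk X (3 ^ k) i j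
  P-true⇒BoundedWalk zero e = 1 , s≤s z≤n , s≤s z≤n , e ∷ []
  P-true⇒BoundedWalk (suc k) e with P-suc-elim k e
  ... | inj₁ e₁ = BoundedWalk-mono (m≤m+n (3 ^ k) _) (P-true⇒BoundedWalk k e₁)
  ... | inj₂ (inj₁ e₂) with ⊗-elim (P X k) (P X k) e₂
  ...   | _ , p , q = BoundedWalk-mono (+-monoʳ-≤ (3 ^ k) (m≤m+n (3 ^ k) _))
                        (P-true⇒BoundedWalk k p ++ᵇ P-true⇒BoundedWalk k q)
  P-true⇒BoundedWalk (suc k) e | inj₂ (inj₂ e₃) with ⊗-elim (P X k ⊗ P X k) (P X k) e₃
  ... | _ , pq , r with ⊗-elim (P X k) (P X k) pq
  ...   | _ , p , q = BoundedWalk-mono (≤-reflexive (sym (3^[1+k]≡3^k+[3^k+3^k] k)))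
                        (P-true⇒BoundedWalk k p ++ᵇ
                          (P-true⇒BoundedWalk k q ++ᵇ P-true⇒BoundedWalk k r))

  BoundedWalk⇒P-true : ∀ k → BoundedWalk X (3 ^ k) i j → P X k i j ≡ true
  BoundedWalk⇒P-true zero (1 , _ , _ , e ∷ []) = e
  BoundedWalk⇒P-true zero (suc (suc _) , _ , s≤s () , _)
  BoundedWalk⇒P-true (suc k) (t , 0<t , t≤3c , w) with t ≤? 3 ^ k
  ... | yes t≤c = P-suc-intro₁ k (BoundedWalk⇒P-true k (t , 0<t , t≤c , w))
  ... | no  t≰c
    with splitBounded (≰⇒> t≰c) (subst (t ≤_) (3^[1+k]≡3^k+[3^k+3^k] k) t≤3c) w
  ...   | _ , u , s , 0<s , s≤2c , v with s ≤? 3 ^ k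
  ...     | yes s≤c = P-suc-intro₂ k (⊗-intro (P X k) (P X k)
                        (BoundedWalk⇒P-true k (Walk⇒BoundedWalk (m^n>0 3 k) u))
                        (BoundedWalk⇒P-true k (s , 0<s , s≤c , v)))
  ...     | no  s≰c with splitBounded (≰⇒> s≰c) s≤2c v
  ...       | _ , u′ , r = P-suc-intro₃ k (⊗-intro (P X k ⊗ P X k) (P X k)
                             (⊗-intro (P X k) (P X k)
                               (BoundedWalk⇒P-true k (Walk⇒BoundedWalk (m^n>0 3 k) u))
                               (BoundedWalk⇒P-true k (Walk⇒BoundedWalk (m^n>0 3 k) u′)))
                             (BoundedWalk⇒P-true k r))

lemma4 : (m n : ℕ) → n ≡ 2 ^ m → (X : BMat n) →
         (i j : Fin n) → star X i j ⇔ ((I n ⊕ P X m) i j ≡ true)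
lemma4 m n refl X i j = mk⇔ star⇒ ⇒star
  where
  n≤3^m : n ≤ 3 ^ m
  n≤3^m = ^-monoˡ-≤ m (s≤s (s≤s z≤n))

  star⇒ : star X i j → (I n ⊕ P X m) i j ≡ true
  star⇒ (t , e) with shorten (pow-true⇒Walk t e)
  ... | zero  , _   , [] = ⊕-introˡ (I n) (P X m) I-refl
  ... | suc s , s<n , w = ⊕-introʳ (I n) (P X m)
                            (BoundedWalk⇒P-true m (suc s , s≤s z≤n , ≤-trans s<n n≤3^m , w))

  ⇒star : (I n ⊕ P X m) i j ≡ true → star X i j
  ⇒star e with ⊕-elim (I n) (P X m) e
  ... | inj₁ eᴵ = 0 , eᴵ
  ... | inj₂ eᴾ with P-true⇒BoundedWalk m eᴾ
  ...   | t , _ , _ , w = t , Walk⇒pow-true w
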